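{- Let $(U,\varphi)$ be the closure space of a finite simple binary matroid on $U$ (i.e. $\varphi$ is the matroid closure operator). Then the canonical base and the (aggregated) $E$-base of $(U,\varphi)$ are equal; in particular the $E$-base is valid.
   Context: A binary matroid is a matroid representable over $\mathrm{GF}(2)$; simple means it has no loops or parallel elements, equivalently its closure space is standard ($\varphi(\{x\})\setminus\{x\}$ closed for all $x$). Quasi-closed $Q$: for all $X\subseteq Q$ with $\varphi(X)\subsetneq\varphi(Q)$, $\varphi(X)\subseteq Q$; pseudo-closed $P$: not closed and inclusion-minimal among quasi-closed $Q$ with $\varphi(Q)=\varphi(P)$. Canonical base: $\{P\to\varphi(P)\setminus P: P \text{ pseudo-closed}\}$. $\varphi^b(X)=\bigcup_{y\in X}\varphi(\{y\})$. $D$-generator of $x$: $A$ with $x\in\varphi(A)$, $x\notin\varphi^b(A)$, and $x\notin\varphi(B)$ whenever $\varphi^b(B)\subsetneq\varphi^b(A)$; $E$-generator: a $D$-generator $A$ with $\varphi(A)$ inclusion-minimal among closures of $D$-generators of $x$. $E$-base: $\{a\to x: x\neq a,x\in\varphi(\{a\})\}\cup\{A\to x: A \text{ an } E\text{ -generator of } x\}$; aggregated form merges implications with equal premises. Valid: the closure operator induced by the implications equals $\varphi$. -}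

module Defs where

open import Data.Nat using (ℕ; zero; suc)
open import Data.Bool using (Bool; true; false; if_then_else_; _xor_)
import Data.Bool.Properties as BoolP
open import Data.Fin using (Fin; zero; suc)
open import Data.Fin.Subset
  using (Subset; _∈_; _∉_; _⊆_; _⊂_; ⁅_⁆; ⋃; ⊥; _─_; Nonempty)
open import Data.Fin.Subset.Properties using (anySubset?; _⊆?_)
open import Data.Vec using (Vec; []; _∷_; replicate; zipWith; tabulate; lookup)
import Data.Vec.Properties as VecP
import Data.List as List
open import Data.Product using (Σ; ∃; _×_; _,_)
open import Data.Sum using (_⊎_)
open import Relation.Nullary using (¬_; Dec; _×-dec_)
open import Relation.Nullary.Decidable using (⌊_⌋)
open import Relation.Binary.PropositionalEquality using (_≡_; _≢_)
open import Function.Bundles using (_⇔_)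

zeroVec : ∀ m → Vec Bool m
zeroVec m = replicate m false

_⊕_ : ∀ {m} → Vec Bool m → Vec Bool m → Vec Bool m
_⊕_ = zipWith _xor_

sumSub : ∀ {m n} → Subset n → (Fin n → Vec Bool m) → Vec Bool m
sumSub {m} []           v = zeroVec m
sumSub {m} (b ∷ S) v = (if b then v zero else zeroVec m) ⊕ sumSub S (λ i → v (suc i))

_≟v_ : ∀ {m} (u w : Vec Bool m) → Dec (u ≡ w)
_≟v_ = VecP.≡-dec BoolP._≟_

-- Binary matroid given by a GF(2)-representation v : U → GF(2)^m,
-- with U = Fin n.

InSpan : ∀ {m n} → (Fin n → Vec Bool m) → Subset n → Fin n → Set
InSpan v X x = ∃ λ (S : Subset _) → S ⊆ X × sumSub S v ≡ v x

inSpan? : ∀ {m n} (v : Fin n → Vec Bool m) X x → Dec (InSpan v X x)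
inSpan? v X x = anySubset? (λ S → (S ⊆? X) ×-dec (sumSub S v ≟v v x))

matroidClosure : ∀ {m n} → (Fin n → Vec Bool m) → Subset n → Subset n
matroidClosure v X = tabulate (λ x → ⌊ inSpan? v X x ⌋)

-- Simple: no loops (no zero vector) and no parallel elements
-- (no two distinct elements with equal vectors).
Simple : ∀ {m n} → (Fin n → Vec Bool m) → Set
Simple {m} v = (∀ x → v x ≢ zeroVec m) × (∀ x y → v x ≡ v y → x ≡ y)

module _ {n : ℕ} (φ : Subset n → Subset n) where

  Closed : Subset n → Set
  Closed X = φ X ≡ X

  QuasiClosed : Subset n → Set
  QuasiClosed Q = ∀ X → X ⊆ Q → φ X ⊂ φ Q → φ X ⊆ Q

  PseudoClosed : Subset n → Set
  PseudoClosed P =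
    ¬ Closed P × QuasiClosed P ×
    (∀ Q → QuasiClosed Q → φ Q ≡ φ P → Q ⊆ P → Q ≡ P)

  φb : Subset n → Subset n
  φb X = ⋃ (List.map (λ y → if lookup X y then φ ⁅ y ⁆ else ⊥) (List.allFin n))

  DGenerator : Fin n → Subset n → Set
  DGenerator x A =
    x ∈ φ A × x ∉ φb A × (∀ B → φb B ⊂ φb A → x ∉ φ B)

  EGenerator : Fin n → Subset n → Set
  EGenerator x A =
    DGenerator x A × (∀ B → DGenerator x B → φ B ⊆ φ A → φ B ≡ φ A)

  Implication : Set
  Implication = Subset n × Subset n

  CanonicalBase : Implication → Set
  CanonicalBase (A , C) = PseudoClosed A × C ≡ φ A ─ A

  EBaseImp : Subset n → Fin n → Set
  EBaseImp A x =
    (∃ λ a → A ≡ ⁅ a ⁆ × x ≢ a × x ∈ φ ⁅ a ⁆) ⊎ EGenerator x A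

  AggregatedEBase : Implication → Set
  AggregatedEBase (A , C) = Nonempty C × (∀ x → x ∈ C ⇔ EBaseImp A x)

RespectsImps : ∀ {n} → (Subset n × Subset n → Set) → Subset n → Set
RespectsImps L Y = ∀ A C → L (A , C) → A ⊆ Y → C ⊆ Y

InducedClosure : ∀ {n} → (Subset n × Subset n → Set) → Subset n → Fin n → Set
InducedClosure L X x = ∀ Y → X ⊆ Y → RespectsImps L Y → x ∈ Y

Valid : ∀ {n} → (Subset n → Subset n) → (Subset n × Subset n → Set) → Set
Valid φ L = ∀ X x → x ∈ φ X ⇔ InducedClosure L X x

{-# OPTIONS --safe #-}
module Submission where

-- Both bases consist exactly of the implications A → ⁅ c ⁆ for which A ∪ ⁅ c ⁆ is a circuit
-- that is also a flat. Every non-closed Y contains such an A with c ∉ Y: take S ⊆ Y of least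
-- size whose GF(2)-sum is the vector of some z ∉ Y. Minimality makes S independent, and any
-- other y ∈ φ S ∖ S is the sum of some T ⊆ S; if y ∉ Y then T competes with S, forcing T = S
-- and y = z, and if y ∈ Y then T has two elements (the matroid is simple), so replacing T by
-- y in S gives a smaller competitor. For non-closed quasi-closed A this forces S = A, which
-- identifies the pseudo-closed sets and gives φ A ∖ A = ⁅ c ⁆; for Y respecting the base it
-- gives validity. Since φ ⁅ y ⁆ = ⁅ y ⁆, the D-generators of x are the A with A ∪ ⁅ x ⁆ a
-- circuit. If such an A is an E-generator but not a flat, the same replacement of T ⊆ A by
-- y ∈ φ A contains a D-generator whose closure lies in φ A but misses an element of T,
-- contradicting E-minimality.

open import Defs
open import Level using (0ℓ)
open import Data.Nat using (ℕ; suc; _≤_; _<_; s≤s)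
open import Data.Nat.Properties
  using (≤-refl; n≤1+n; m≤n⇒m≤1+n; <⇒≱; ≮⇒≥; _<?_; module ≤-Reasoning)
open import Data.Nat.Induction using (<-wellFounded)
open import Data.Bool using (Bool; true; false; if_then_else_; _xor_)
open import Data.Bool.Properties
  using (xor-assoc; xor-comm; xor-identityˡ; xor-identityʳ; xor-same; T-≡)
open import Data.Fin using (Fin; zero; suc)
open import Data.Fin.Properties using (any?) renaming (_≟_ to _≟ᶠ_)
open import Data.Fin.Subset
  using (Subset; _∈_; _∉_; _⊆_; _⊂_; ⁅_⁆; ⋃; ⊥; _─_; _-_; Nonempty; ∣_∣)
open import Data.Fin.Subset.Properties
  using ( anySubset?; _⊆?_; _⊂?_; _∈?_; drop-there; ∉⊥; x∈⁅x⁆; x∈⁅y⁆⇒x≡y; x∉⁅y⁆⇒x≢y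
        ; ⊆-refl; ⊆-trans; ⊆-antisym; nonempty?; Empty-unique; p⊂q⇒∣p∣<∣q∣
        ; x∈p⇒∣p-x∣<∣p∣; x∈p∧x≢y⇒x∈p-y; x∈p∧x∉q⇒x∈p─q; p─q⊆p; x∈p∪q⁻; x∈p∪q⁺ )
open import Data.Vec using (Vec; []; _∷_; here; there; lookup)
open import Data.Vec.Properties
  using ( zipWith-assoc; zipWith-comm; zipWith-identityˡ; zipWith-identityʳ
        ; lookup∘tabulate; []=⇒lookup; lookup⇒[]= )
open import Data.List using (List; []; _∷_; allFin; map)
import Data.List.Relation.Unary.Any as Any
open Any using (Any)
open import Data.List.Relation.Unary.Any.Properties using (map⁺; map⁻)
open import Data.List.Membership.Propositional using (lose)
open import Data.List.Membership.Propositional.Properties using (∈-allFin)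
open import Data.Product using (∃; ∃₂; _×_; _,_; proj₁; proj₂)
import Data.Product as Product
open import Data.Sum using (_⊎_; inj₁; inj₂; [_,_])
import Data.Sum as Sum
open import Function using (_∘_; id)
open import Function.Bundles using (_⇔_; mk⇔; Equivalence)
import Function.Properties.Equivalence as ⇔
open import Induction.WellFounded using (module All)
open import Relation.Binary.Construct.On using () renaming (wellFounded to on-wellFounded)
open import Relation.Nullary using (¬_; yes; no; _×-dec_; ¬?; contradiction)
open import Relation.Nullary.Decidable using (toWitness; fromWitness; decidable-stable)
open import Relation.Unary using (Decidable)
open import Relation.Binary.PropositionalEquality
  using (_≡_; _≢_; refl; sym; trans; cong; cong₂; subst; subst₂; module ≡-Reasoning)

⊕-self : ∀ {k} (u : Vec Bool k) → u ⊕ u ≡ zeroVec k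
⊕-self []      = refl
⊕-self (b ∷ u) = cong₂ _∷_ (xor-same b) (⊕-self u)

module _ {k : ℕ} where
  open ≡-Reasoning

  ⊕-assoc : (u w z : Vec Bool k) → (u ⊕ w) ⊕ z ≡ u ⊕ (w ⊕ z)
  ⊕-assoc = zipWith-assoc xor-assoc

  ⊕-comm : (u w : Vec Bool k) → u ⊕ w ≡ w ⊕ u
  ⊕-comm = zipWith-comm xor-comm

  ⊕-identityˡ : (u : Vec Bool k) → zeroVec k ⊕ u ≡ u
  ⊕-identityˡ = zipWith-identityˡ xor-identityˡ

  ⊕-identityʳ : (u : Vec Bool k) → u ⊕ zeroVec k ≡ u
  ⊕-identityʳ = zipWith-identityʳ xor-identityʳ

  ⊕-cancelʳ : (u w : Vec Bool k) → (u ⊕ w) ⊕ w ≡ u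
  ⊕-cancelʳ u w = begin
    (u ⊕ w) ⊕ w   ≡⟨ ⊕-assoc u w w ⟩
    u ⊕ (w ⊕ w)   ≡⟨ cong (u ⊕_) (⊕-self w) ⟩
    u ⊕ zeroVec k ≡⟨ ⊕-identityʳ u ⟩
    u             ∎

  ⊕≡zero⇒≡ : (u w : Vec Bool k) → u ⊕ w ≡ zeroVec k → u ≡ w
  ⊕≡zero⇒≡ u w u⊕w≡0 = begin
    u             ≡⟨ ⊕-cancelʳ u w ⟨
    (u ⊕ w) ⊕ w   ≡⟨ cong (_⊕ w) u⊕w≡0 ⟩
    zeroVec k ⊕ w ≡⟨ ⊕-identityˡ w ⟩
    w             ∎

  ⊕-interchange : (a b c d : Vec Bool k) → (a ⊕ b) ⊕ (c ⊕ d) ≡ (a ⊕ c) ⊕ (b ⊕ d)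
  ⊕-interchange a b c d = begin
    (a ⊕ b) ⊕ (c ⊕ d) ≡⟨ ⊕-assoc a b (c ⊕ d) ⟩
    a ⊕ (b ⊕ (c ⊕ d)) ≡⟨ cong (a ⊕_) (⊕-assoc b c d) ⟨
    a ⊕ ((b ⊕ c) ⊕ d) ≡⟨ cong (λ e → a ⊕ (e ⊕ d)) (⊕-comm b c) ⟩
    a ⊕ ((c ⊕ b) ⊕ d) ≡⟨ cong (a ⊕_) (⊕-assoc c b d) ⟩
    a ⊕ (c ⊕ (b ⊕ d)) ≡⟨ ⊕-assoc a c (b ⊕ d) ⟨
    (a ⊕ c) ⊕ (b ⊕ d) ∎

module _ {m : ℕ} where

  if-xor : ∀ b c (u : Vec Bool m) →
           (if b xor c then u else zeroVec m) ≡
           (if b then u else zeroVec m) ⊕ (if c then u else zeroVec m)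
  if-xor true  true  u = sym (⊕-self u)
  if-xor true  false u = sym (⊕-identityʳ u)
  if-xor false c     u = sym (⊕-identityˡ _)

  sumSub-⊕ : ∀ {k} (p q : Subset k) (f : Fin k → Vec Bool m) →
             sumSub (p ⊕ q) f ≡ sumSub p f ⊕ sumSub q f
  sumSub-⊕ []      []      f = sym (⊕-identityˡ _)
  sumSub-⊕ (b ∷ p) (c ∷ q) f =
    trans (cong₂ _⊕_ (if-xor b c (f zero)) (sumSub-⊕ p q (f ∘ suc))) (⊕-interchange _ _ _ _)

  sumSub-⊥ : ∀ {k} (f : Fin k → Vec Bool m) → sumSub ⊥ f ≡ zeroVec m
  sumSub-⊥ {0}     f = refl
  sumSub-⊥ {suc k} f = trans (⊕-identityˡ _) (sumSub-⊥ (f ∘ suc))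

  sumSub-⁅⁆ : ∀ {k} (i : Fin k) (f : Fin k → Vec Bool m) → sumSub ⁅ i ⁆ f ≡ f i
  sumSub-⁅⁆ zero    f = trans (cong (f zero ⊕_) (sumSub-⊥ (f ∘ suc))) (⊕-identityʳ _)
  sumSub-⁅⁆ (suc i) f = trans (⊕-identityˡ _) (sumSub-⁅⁆ i (f ∘ suc))

  sumSub-closed : (P : Vec Bool m → Set) → P (zeroVec m) → (∀ {a b} → P a → P b → P (a ⊕ b)) →
                  ∀ {k} (T : Subset k) (f : Fin k → Vec Bool m) →
                  (∀ {i} → i ∈ T → P (f i)) → P (sumSub T f)
  sumSub-closed P P0 P⊕ []          f PT = P0
  sumSub-closed P P0 P⊕ (true ∷ T)  f PT =
    P⊕ (PT here) (sumSub-closed P P0 P⊕ T (f ∘ suc) (PT ∘ there))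
  sumSub-closed P P0 P⊕ (false ∷ T) f PT =
    P⊕ P0 (sumSub-closed P P0 P⊕ T (f ∘ suc) (PT ∘ there))

∈-⊕⁻ : ∀ {k i} (p q : Subset k) → i ∈ p ⊕ q → (i ∈ p × i ∉ q) ⊎ (i ∉ p × i ∈ q)
∈-⊕⁻ (true  ∷ p) (false ∷ q) here      = inj₁ (here , λ ())
∈-⊕⁻ (false ∷ p) (true  ∷ q) here      = inj₂ ((λ ()) , here)
∈-⊕⁻ (_     ∷ p) (_     ∷ q) (there h) =
  Sum.map (Product.map there (_∘ drop-there)) (Product.map (_∘ drop-there) there) (∈-⊕⁻ p q h)

∈-⊕⁺ʳ : ∀ {k i} {p q : Subset k} → i ∉ p → i ∈ q → i ∈ p ⊕ q
∈-⊕⁺ʳ {p = false ∷ p} {true ∷ q} i∉p here      = here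
∈-⊕⁺ʳ {p = true  ∷ p} {_    ∷ q} i∉p here      = contradiction here i∉p
∈-⊕⁺ʳ {p = _     ∷ p} {_    ∷ q} i∉p (there h) = there (∈-⊕⁺ʳ (i∉p ∘ there) h)

x∈p─q⇒x∉q : ∀ {k i} (p q : Subset k) → i ∈ p ─ q → i ∉ q
x∈p─q⇒x∉q            (true  ∷ p) (false ∷ q) here      = λ ()
x∈p─q⇒x∉q {i = zero} (false ∷ p) (false ∷ q) ()
x∈p─q⇒x∉q {i = zero} (_     ∷ p) (true  ∷ q) ()
x∈p─q⇒x∉q            (_     ∷ p) (_     ∷ q) (there h) = x∈p─q⇒x∉q p q h ∘ drop-there

∣p⊕⁅x⁆∣≤1+∣p∣ : ∀ {k} (p : Subset k) x → ∣ p ⊕ ⁅ x ⁆ ∣ ≤ suc ∣ p ∣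
∣p⊕⁅x⁆∣≤1+∣p∣ (true  ∷ p) zero    rewrite ⊕-identityʳ p = m≤n⇒m≤1+n (n≤1+n ∣ p ∣)
∣p⊕⁅x⁆∣≤1+∣p∣ (false ∷ p) zero    rewrite ⊕-identityʳ p = ≤-refl
∣p⊕⁅x⁆∣≤1+∣p∣ (true  ∷ p) (suc x) = s≤s (∣p⊕⁅x⁆∣≤1+∣p∣ p x)
∣p⊕⁅x⁆∣≤1+∣p∣ (false ∷ p) (suc x) = ∣p⊕⁅x⁆∣≤1+∣p∣ p x

∈-⋃⁻ : ∀ {k i} (ps : List (Subset k)) → i ∈ ⋃ ps → Any (i ∈_) ps
∈-⋃⁻ []       i∈⊥ = contradiction i∈⊥ ∉⊥
∈-⋃⁻ (p ∷ ps) h   with x∈p∪q⁻ p (⋃ ps) h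
... | inj₁ i∈p  = Any.here i∈p
... | inj₂ i∈ps = Any.there (∈-⋃⁻ ps i∈ps)

∈-⋃⁺ : ∀ {k i} {ps : List (Subset k)} → Any (i ∈_) ps → i ∈ ⋃ ps
∈-⋃⁺ (Any.here h)  = x∈p∪q⁺ (inj₁ h)
∈-⋃⁺ (Any.there h) = x∈p∪q⁺ (inj₂ (∈-⋃⁺ h))

module _ {k : ℕ} where

  ⁅⁆⊆ : {p : Subset k} {x : Fin k} → x ∈ p → ⁅ x ⁆ ⊆ p
  ⁅⁆⊆ {p} {x} x∈p y∈⁅x⁆ = subst (_∈ p) (sym (x∈⁅y⁆⇒x≡y x y∈⁅x⁆)) x∈p

  ⊕-⊆ : {p q r : Subset k} → p ⊆ r → q ⊆ r → p ⊕ q ⊆ r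
  ⊕-⊆ {p} {q} p⊆r q⊆r h = [ p⊆r ∘ proj₁ , q⊆r ∘ proj₂ ] (∈-⊕⁻ p q h)

  ∈-⊕-⊆⁻ : {p q : Subset k} → q ⊆ p → ∀ {i} → i ∈ p ⊕ q → i ∈ p × i ∉ q
  ∈-⊕-⊆⁻ {p} {q} q⊆p h =
    [ id , (λ (i∉p , i∈q) → contradiction (q⊆p i∈q) i∉p) ] (∈-⊕⁻ p q h)

  ⊕-⊂ : {p q : Subset k} → q ⊆ p → ∀ {i} → i ∈ q → p ⊕ q ⊂ p
  ⊕-⊂ q⊆p {i} i∈q = proj₁ ∘ ∈-⊕-⊆⁻ q⊆p , i , q⊆p i∈q , (λ h → proj₂ (∈-⊕-⊆⁻ q⊆p h) i∈q)

  ⊆⇒⊂⊎≡ : {p q : Subset k} → p ⊆ q → p ⊂ q ⊎ p ≡ q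
  ⊆⇒⊂⊎≡ {p} {q} p⊆q with p ⊂? q
  ... | yes p⊂q = inj₁ p⊂q
  ... | no  p⊄q = inj₂ (⊆-antisym p⊆q λ {x} x∈q →
                    decidable-stable (x ∈? p) (λ x∉p → p⊄q (p⊆q , x , x∈q , x∉p)))

  MinCard : (Subset k → Set) → Subset k → Set
  MinCard P S = P S × (∀ T → P T → ∣ S ∣ ≤ ∣ T ∣)

  minCard : {P : Subset k → Set} → Decidable P → ∀ {S} → P S → ∃ (MinCard P)
  minCard {P} P? {S} =
    All.wfRec (on-wellFounded ∣_∣ <-wellFounded) 0ℓ (λ S → P S → ∃ (MinCard P)) step S
    where
    step : ∀ S → (∀ {T} → ∣ T ∣ < ∣ S ∣ → P T → ∃ (MinCard P)) → P S → ∃ (MinCard P)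
    step S smaller pS with anySubset? (λ T → P? T ×-dec (∣ T ∣ <? ∣ S ∣))
    ... | yes (T , pT , T<S) = smaller T<S pT
    ... | no  none           = S , pS , λ T pT → ≮⇒≥ (λ T<S → none (T , pT , T<S))

  -- For T ⊆ S and w ∉ S this is (S ∖ T) ∪ ⁅ w ⁆.
  exchange : Subset k → Subset k → Fin k → Subset k
  exchange S T w = (S ⊕ T) ⊕ ⁅ w ⁆

  module _ {S T : Subset k} {w : Fin k} (T⊆S : T ⊆ S) where

    ∈-exchange⁻ : ∀ {i} → i ∈ exchange S T w → (i ∈ S × i ∉ T) ⊎ i ≡ w
    ∈-exchange⁻ h with ∈-⊕⁻ (S ⊕ T) ⁅ w ⁆ h
    ... | inj₁ (i∈S⊕T , _) = inj₁ (∈-⊕-⊆⁻ T⊆S i∈S⊕T)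
    ... | inj₂ (_ , i∈⁅w⁆) = inj₂ (x∈⁅y⁆⇒x≡y w i∈⁅w⁆)

    ∈-exchange⇒∈ : ∀ {i} → i ∈ exchange S T w → i ≢ w → i ∈ S
    ∈-exchange⇒∈ h i≢w = [ proj₁ , (λ i≡w → contradiction i≡w i≢w) ] (∈-exchange⁻ h)

    ∈-exchange⇒∉ : w ∉ S → ∀ {i} → i ∈ exchange S T w → i ∉ T
    ∈-exchange⇒∉ w∉S h with ∈-exchange⁻ h
    ... | inj₁ (_ , i∉T) = i∉T
    ... | inj₂ refl      = w∉S ∘ T⊆S

    ∉-exchange : ∀ {x} → x ∉ S → x ≢ w → x ∉ exchange S T w
    ∉-exchange x∉S x≢w x∈R = [ x∉S ∘ proj₁ , x≢w ] (∈-exchange⁻ x∈R)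

    exchange-⊆ : ∀ {Y} → S ⊆ Y → w ∈ Y → exchange S T w ⊆ Y
    exchange-⊆ S⊆Y w∈Y h = [ S⊆Y ∘ proj₁ , (λ { refl → w∈Y }) ] (∈-exchange⁻ h)

    ∣exchange∣<∣∣ : ∀ {t t'} → t ∈ T → t' ∈ T → t ≢ t' → ∣ exchange S T w ∣ < ∣ S ∣
    ∣exchange∣<∣∣ {t} {t'} t∈T t'∈T t≢t' = begin-strict
      ∣ (S ⊕ T) ⊕ ⁅ w ⁆ ∣ ≤⟨ ∣p⊕⁅x⁆∣≤1+∣p∣ (S ⊕ T) w ⟩
      suc ∣ S ⊕ T ∣       ≤⟨ p⊂q⇒∣p∣<∣q∣ S⊕T⊂S-t ⟩
      ∣ S - t ∣           <⟨ x∈p⇒∣p-x∣<∣p∣ (T⊆S t∈T) ⟩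
      ∣ S ∣               ∎
      where
      open ≤-Reasoning
      S⊕T⊆S-t : S ⊕ T ⊆ S - t
      S⊕T⊆S-t h = let i∈S , i∉T = ∈-⊕-⊆⁻ T⊆S h in x∈p∧x≢y⇒x∈p-y i∈S λ { refl → i∉T t∈T }
      S⊕T⊂S-t : S ⊕ T ⊂ S - t
      S⊕T⊂S-t = S⊕T⊆S-t , t' , x∈p∧x≢y⇒x∈p-y (T⊆S t'∈T) (t≢t' ∘ sym)
                        , (λ h → proj₂ (∈-⊕-⊆⁻ T⊆S h) t'∈T)

module _ {n : ℕ} (φ : Subset n → Subset n)
         (extensive : ∀ {X} → X ⊆ φ X) (closure : ∀ {X Y} → X ⊆ φ Y → φ X ⊆ φ Y) where

  sound∧complete⇒valid : {L : Subset n × Subset n → Set} →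
                         (∀ {A C} → L (A , C) → C ⊆ φ A) →
                         (∀ {Y} → RespectsImps L Y → φ Y ⊆ Y) →
                         Valid φ L
  sound∧complete⇒valid {L} sound complete X x = mk⇔ closed⇒induced induced⇒closed
    where
    closed⇒induced : x ∈ φ X → InducedClosure L X x
    closed⇒induced x∈φX Y X⊆Y respects = complete respects (closure (extensive ∘ X⊆Y) x∈φX)

    induced⇒closed : InducedClosure L X x → x ∈ φ X
    induced⇒closed induced =
      induced (φ X) extensive (λ A C imp A⊆φX → ⊆-trans (sound imp) (closure A⊆φX))

module _ {m n : ℕ} (v : Fin n → Vec Bool m) where

  φ : Subset n → Subset n
  φ = matroidClosure v

  σ : Subset n → Vec Bool m
  σ S = sumSub S v

  ∈φ⁻ : ∀ {X x} → x ∈ φ X → InSpan v X x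
  ∈φ⁻ {X} {x} x∈φX = toWitness {a? = inSpan? v X x}
    (Equivalence.from T-≡ (trans (sym (lookup∘tabulate _ x)) ([]=⇒lookup x∈φX)))

  ∈φ⁺ : ∀ {X x} → InSpan v X x → x ∈ φ X
  ∈φ⁺ {X} {x} spans =
    lookup⇒[]= x (φ X) (trans (lookup∘tabulate _ x) (Equivalence.to T-≡ (fromWitness spans)))

  σ∈φ : ∀ {A x} → σ A ≡ v x → x ∈ φ A
  σ∈φ σA = ∈φ⁺ (_ , ⊆-refl , σA)

  φ-extensive : ∀ {X} → X ⊆ φ X
  φ-extensive {X} {x} x∈X = ∈φ⁺ (⁅ x ⁆ , ⁅⁆⊆ x∈X , sumSub-⁅⁆ x v)

  φ-monotone : ∀ {X Y} → X ⊆ Y → φ X ⊆ φ Y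
  φ-monotone X⊆Y x∈φX with ∈φ⁻ x∈φX
  ... | S , S⊆X , σS = ∈φ⁺ (S , X⊆Y ∘ S⊆X , σS)

  φ-closure : ∀ {X Y} → X ⊆ φ Y → φ X ⊆ φ Y
  φ-closure {X} {Y} X⊆φY x∈φX with ∈φ⁻ x∈φX
  ... | T , T⊆X , σT =
    ∈φ⁺ (subst Spanned σT (sumSub-closed Spanned ⊥-spans ⊕-spans T v (∈φ⁻ ∘ X⊆φY ∘ T⊆X)))
    where
    Spanned : Vec Bool m → Set
    Spanned u = ∃ λ S → S ⊆ Y × σ S ≡ u

    ⊥-spans : Spanned (zeroVec m)
    ⊥-spans = ⊥ , (λ i∈⊥ → contradiction i∈⊥ ∉⊥) , sumSub-⊥ v

    ⊕-spans : ∀ {a b} → Spanned a → Spanned b → Spanned (a ⊕ b)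
    ⊕-spans (A , A⊆Y , σA) (B , B⊆Y , σB) =
      A ⊕ B , ⊕-⊆ A⊆Y B⊆Y , trans (sumSub-⊕ A B v) (cong₂ _⊕_ σA σB)

  σ-exchange : ∀ {S T w} → σ T ≡ v w → σ (exchange S T w) ≡ σ S
  σ-exchange {S} {T} {w} σT = begin
    σ ((S ⊕ T) ⊕ ⁅ w ⁆) ≡⟨ sumSub-⊕ (S ⊕ T) ⁅ w ⁆ v ⟩
    σ (S ⊕ T) ⊕ σ ⁅ w ⁆ ≡⟨ cong₂ _⊕_ (sumSub-⊕ S T v) (sumSub-⁅⁆ w v) ⟩
    (σ S ⊕ σ T) ⊕ v w   ≡⟨ cong (λ u → (σ S ⊕ u) ⊕ v w) σT ⟩
    (σ S ⊕ v w) ⊕ v w   ≡⟨ ⊕-cancelʳ (σ S) (v w) ⟩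
    σ S                 ∎
    where open ≡-Reasoning

  Independent : Subset n → Set
  Independent A = ∀ T → T ⊆ A → σ T ≡ zeroVec m → T ≡ ⊥

  σ-injective : ∀ {S A B} → Independent S → A ⊆ S → B ⊆ S → σ A ≡ σ B → A ≡ B
  σ-injective {A = A} {B} independent A⊆S B⊆S σA≡σB =
    ⊕≡zero⇒≡ A B (independent (A ⊕ B) (⊕-⊆ A⊆S B⊆S)
      (trans (sumSub-⊕ A B v) (trans (cong (_⊕ σ B) σA≡σB) (⊕-self (σ B)))))

  σ-injective-⁅⁆ : ∀ {S Q t} → Independent S → Q ⊆ S → t ∈ S → σ Q ≡ v t → Q ≡ ⁅ t ⁆
  σ-injective-⁅⁆ {t = t} independent Q⊆S t∈S σQ =
    σ-injective independent Q⊆S (⁅⁆⊆ t∈S) (trans σQ (sym (sumSub-⁅⁆ t v)))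

  minimal⇒independent : ∀ {S} → (∀ B → B ⊂ S → σ B ≢ σ S) → Independent S
  minimal⇒independent {S} minimal T T⊆S σT≡0 with nonempty? T
  ... | no  T-empty   = Empty-unique T-empty
  ... | yes (i , i∈T) = contradiction σ[S⊕T]≡σS (minimal (S ⊕ T) (⊕-⊂ T⊆S i∈T))
    where
    σ[S⊕T]≡σS : σ (S ⊕ T) ≡ σ S
    σ[S⊕T]≡σS = trans (sumSub-⊕ S T v) (trans (cong (σ S ⊕_) σT≡0) (⊕-identityʳ (σ S)))

  -- Circuit A c says that A ∪ ⁅ c ⁆ is a circuit and c ∉ A; ClosedCircuit A c says that this
  -- circuit is moreover a flat.
  Circuit : Subset n → Fin n → Set
  Circuit A c = c ∉ A × σ A ≡ v c × Independent A

  ClosedCircuit : Subset n → Fin n → Set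
  ClosedCircuit A c = Circuit A c × (∀ {y} → y ∈ φ A → y ∉ A → y ≡ c)

  circuit-minimal : ∀ {A T x} → Circuit A x → T ⊆ A → x ∈ φ T → T ≡ A
  circuit-minimal (_ , σA , independent) T⊆A x∈φT with ∈φ⁻ x∈φT
  ... | S , S⊆T , σS = ⊆-antisym T⊆A (λ a∈A → S⊆T (subst (_ ∈_) (sym S≡A) a∈A))
    where
    S≡A = σ-injective independent (T⊆A ∘ S⊆T) ⊆-refl (trans σS (sym σA))

  circuit-within : ∀ {X x} → x ∉ X → x ∈ φ X → ∃ λ B → B ⊆ X × Circuit B x
  circuit-within {X} {x} x∉X x∈φX with ∈φ⁻ x∈φX
  ... | S , S⊆X , σS with minCard (λ B → (B ⊆? X) ×-dec (σ B ≟v v x)) (S⊆X , σS)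
  ... | B , (B⊆X , σB) , least = B , B⊆X , x∉X ∘ B⊆X , σB , minimal⇒independent proper
    where
    proper : ∀ C → C ⊂ B → σ C ≢ σ B
    proper C C⊂B σC≡σB =
      <⇒≱ (p⊂q⇒∣p∣<∣q∣ C⊂B) (least C (⊆-trans (proj₁ C⊂B) B⊆X , trans σC≡σB σB))

  -- If Q ⊆ exchange S T w sums to v t, then Q (if w ∉ Q) or (Q ∖ ⁅ w ⁆) ⊕ T (if w ∈ Q) is a
  -- subset of S with that sum, hence ⁅ t ⁆ by independence; the first is disjoint from T and
  -- the second contains T.
  exchange-loses : ∀ {S T w t} → Independent S → T ⊆ S → w ∉ S → σ T ≡ v w → t ∈ T →
                   t ∈ φ (exchange S T w) → T ⊆ ⁅ t ⁆
  exchange-loses {S} {T} {w} {t} independent T⊆S w∉S σT t∈T t∈φR {t'} t'∈T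
    with ∈φ⁻ t∈φR
  ... | Q , Q⊆R , σQ with w ∈? Q
  ...   | no w∉Q = contradiction t∈T (∈-exchange⇒∉ T⊆S w∉S (Q⊆R t∈Q))
    where
    Q⊆S : Q ⊆ S
    Q⊆S i∈Q = ∈-exchange⇒∈ T⊆S (Q⊆R i∈Q) (λ { refl → w∉Q i∈Q })
    t∈Q : t ∈ Q
    t∈Q = subst (t ∈_) (sym (σ-injective-⁅⁆ independent Q⊆S (T⊆S t∈T) σQ)) (x∈⁅x⁆ t)
  ...   | yes w∈Q = subst (t' ∈_) (σ-injective-⁅⁆ independent Q*⊆S (T⊆S t∈T) σQ*) t'∈Q*
    where
    Q* : Subset _
    Q* = (Q ⊕ ⁅ w ⁆) ⊕ T

    Q⊕⁅w⁆⊆S : Q ⊕ ⁅ w ⁆ ⊆ S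
    Q⊕⁅w⁆⊆S h = let i∈Q , i∉⁅w⁆ = ∈-⊕-⊆⁻ (⁅⁆⊆ w∈Q) h
                in ∈-exchange⇒∈ T⊆S (Q⊆R i∈Q) (x∉⁅y⁆⇒x≢y i∉⁅w⁆)

    Q*⊆S : Q* ⊆ S
    Q*⊆S = ⊕-⊆ Q⊕⁅w⁆⊆S T⊆S

    σQ* : σ Q* ≡ v t
    σQ* = begin
      σ ((Q ⊕ ⁅ w ⁆) ⊕ T)   ≡⟨ sumSub-⊕ (Q ⊕ ⁅ w ⁆) T v ⟩
      σ (Q ⊕ ⁅ w ⁆) ⊕ σ T   ≡⟨ cong₂ _⊕_ (sumSub-⊕ Q ⁅ w ⁆ v) σT ⟩
      (σ Q ⊕ σ ⁅ w ⁆) ⊕ v w ≡⟨ cong₂ (λ a b → (a ⊕ b) ⊕ v w) σQ (sumSub-⁅⁆ w v) ⟩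
      (v t ⊕ v w) ⊕ v w     ≡⟨ ⊕-cancelʳ (v t) (v w) ⟩
      v t                   ∎
      where open ≡-Reasoning

    t'∈Q* : t' ∈ Q*
    t'∈Q* = ∈-⊕⁺ʳ (λ h → ∈-exchange⇒∉ T⊆S w∉S (Q⊆R (proj₁ (∈-⊕-⊆⁻ (⁅⁆⊆ w∈Q) h))) t'∈T) t'∈T

  closedCircuit-⊆ : ∀ {A c X} → ClosedCircuit A c → X ⊆ φ A → c ∉ X → X ⊆ A
  closedCircuit-⊆ {A} (_ , flat) X⊆φA c∉X {x} x∈X =
    decidable-stable (x ∈? A) (λ x∉A → c∉X (subst (_∈ _) (flat (X⊆φA x∈X) x∉A) x∈X))

  closedCircuit-unique : ∀ {A c y} → ClosedCircuit A c → Circuit A y → y ≡ c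
  closedCircuit-unique (_ , flat) (y∉A , σA , _) = flat (σ∈φ σA) y∉A

  closedCircuit-φ─ : ∀ {A c} → ClosedCircuit A c → φ A ─ A ≡ ⁅ c ⁆
  closedCircuit-φ─ {A} {c} ((c∉A , σA , _) , flat) = ⊆-antisym
    (λ h → subst (_∈ ⁅ c ⁆) (sym (flat (p─q⊆p (φ A) A h) (x∈p─q⇒x∉q (φ A) A h))) (x∈⁅x⁆ c))
    (⁅⁆⊆ (x∈p∧x∉q⇒x∈p─q (σ∈φ σA) c∉A))

  closedCircuit-proper-closed : ∀ {A c X} → ClosedCircuit A c → X ⊂ A → φ X ⊆ X
  closedCircuit-proper-closed {A} {c} {X} cc@(circuit@(_ , _ , independent) , _)
                              (X⊆A , a , a∈A , a∉X) {y} y∈φX with ∈φ⁻ y∈φX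
  ... | T , T⊆X , σT = T⊆X (subst (y ∈_) (sym T≡⁅y⁆) (x∈⁅x⁆ y))
    where
    c∉φX : c ∉ φ X
    c∉φX c∈φX = a∉X (subst (a ∈_) (sym (circuit-minimal circuit X⊆A c∈φX)) a∈A)
    y∈A : y ∈ A
    y∈A = closedCircuit-⊆ cc (φ-monotone X⊆A) c∉φX y∈φX
    T≡⁅y⁆ : T ≡ ⁅ y ⁆
    T≡⁅y⁆ = σ-injective-⁅⁆ independent (X⊆A ∘ T⊆X) y∈A σT

  closedCircuit⇒pseudoClosed : ∀ {A c} → ClosedCircuit A c → PseudoClosed φ A
  closedCircuit⇒pseudoClosed {A} {c} cc@((c∉A , σA , _) , _) = not-closed , quasi-closed , minimal
    where
    not-closed : ¬ Closed φ A
    not-closed φA≡A = c∉A (subst (c ∈_) φA≡A (σ∈φ σA))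

    quasi-closed : QuasiClosed φ A
    quasi-closed X X⊆A (_ , w , w∈φA , w∉φX) with ⊆⇒⊂⊎≡ X⊆A
    ... | inj₁ X⊂A  = ⊆-trans (closedCircuit-proper-closed cc X⊂A) X⊆A
    ... | inj₂ refl = contradiction w∈φA w∉φX

    minimal : ∀ Q → QuasiClosed φ Q → φ Q ≡ φ A → Q ⊆ A → Q ≡ A
    minimal Q _ φQ≡φA Q⊆A with ⊆⇒⊂⊎≡ Q⊆A
    ... | inj₁ Q⊂A = contradiction (Q⊆A (closedCircuit-proper-closed cc Q⊂A c∈φQ)) c∉A
      where c∈φQ = subst (c ∈_) (sym φQ≡φA) (σ∈φ σA)
    ... | inj₂ Q≡A = Q≡A

  Escapes : Subset n → Subset n → Set
  Escapes Y S = S ⊆ Y × ∃ λ z → z ∉ Y × σ S ≡ v z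

  escapes? : ∀ Y → Decidable (Escapes Y)
  escapes? Y S = (S ⊆? Y) ×-dec any? (λ z → ¬? (z ∈? Y) ×-dec (σ S ≟v v z))

  module _ (simple : Simple v) where

    v-injective : ∀ x y → v x ≡ v y → x ≡ y
    v-injective = proj₂ simple

    σ≡v⇒nonempty : ∀ {T y} → σ T ≡ v y → Nonempty T
    σ≡v⇒nonempty {T} {y} σT with nonempty? T
    ... | yes T-nonempty = T-nonempty
    ... | no  T-empty    = contradiction v≡0 (proj₁ simple y)
      where
      v≡0 = trans (sym σT) (trans (cong σ (Empty-unique T-empty)) (sumSub-⊥ v))

    ⊆⁅⁆-σ : ∀ {T t y} → T ⊆ ⁅ t ⁆ → σ T ≡ v y → y ≡ t
    ⊆⁅⁆-σ {T} {t} {y} T⊆⁅t⁆ σT with σ≡v⇒nonempty σT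
    ... | s , s∈T with x∈⁅y⁆⇒x≡y t (T⊆⁅t⁆ s∈T)
    ... | refl = v-injective y t (begin
      v y     ≡⟨ σT ⟨
      σ T     ≡⟨ cong σ (⊆-antisym T⊆⁅t⁆ (⁅⁆⊆ s∈T)) ⟩
      σ ⁅ t ⁆ ≡⟨ sumSub-⁅⁆ t v ⟩
      v t     ∎)
      where open ≡-Reasoning

    φ⁅⁆ : ∀ {x y} → x ∈ φ ⁅ y ⁆ → x ≡ y
    φ⁅⁆ x∈φ⁅y⁆ with ∈φ⁻ x∈φ⁅y⁆
    ... | T , T⊆⁅y⁆ , σT = ⊆⁅⁆-σ T⊆⁅y⁆ σT

    two-elements : ∀ {T y} → y ∉ T → σ T ≡ v y → ∃₂ λ t t' → t ∈ T × t' ∈ T × t ≢ t'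
    two-elements {T} {y} y∉T σT with σ≡v⇒nonempty σT
    ... | t , t∈T with any? (λ t' → (t' ∈? T) ×-dec ¬? (t ≟ᶠ t'))
    ... | yes (t' , t'∈T , t≢t') = t , t' , t∈T , t'∈T , t≢t'
    ... | no  ∄t'                = contradiction (subst (_∈ T) (sym (⊆⁅⁆-σ T⊆⁅t⁆ σT)) t∈T) y∉T
      where
      T⊆⁅t⁆ : T ⊆ ⁅ t ⁆
      T⊆⁅t⁆ {t'} t'∈T =
        subst (_∈ ⁅ t ⁆) (decidable-stable (t ≟ᶠ t') (λ t≢t' → ∄t' (t' , t'∈T , t≢t'))) (x∈⁅x⁆ t)

    φb-id : ∀ B → φb φ B ≡ B
    φb-id B = ⊆-antisym φbB⊆B B⊆φbB
      where
      part : Fin n → Subset n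
      part y = if lookup B y then φ ⁅ y ⁆ else ⊥

      ∈-part⁻ : ∀ {x} y → x ∈ part y → x ∈ B
      ∈-part⁻ y h with lookup B y in eq
      ... | true  = subst (_∈ B) (sym (φ⁅⁆ h)) (lookup⇒[]= y B eq)
      ... | false = contradiction h ∉⊥

      ∈-part⁺ : ∀ {x} → x ∈ B → x ∈ part x
      ∈-part⁺ {x} x∈B rewrite []=⇒lookup x∈B = φ-extensive (x∈⁅x⁆ x)

      φbB⊆B : φb φ B ⊆ B
      φbB⊆B h with Any.satisfied (map⁻ (∈-⋃⁻ (map part (allFin n)) h))
      ... | y , x∈part = ∈-part⁻ y x∈part

      B⊆φbB : B ⊆ φb φ B
      B⊆φbB {x} x∈B = ∈-⋃⁺ (map⁺ (lose (∈-allFin x) (∈-part⁺ x∈B)))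

    dGenerator⇒circuit : ∀ {x A} → DGenerator φ x A → Circuit A x
    dGenerator⇒circuit {x} {A} (x∈φA , x∉φbA , minimal) = x∉A , σA , minimal⇒independent σ-proper
      where
      x∉A : x ∉ A
      x∉A x∈A = x∉φbA (subst (x ∈_) (sym (φb-id A)) x∈A)

      proper : ∀ B → B ⊂ A → x ∉ φ B
      proper B B⊂A = minimal B (subst₂ _⊂_ (sym (φb-id B)) (sym (φb-id A)) B⊂A)

      σA : σ A ≡ v x
      σA with ∈φ⁻ x∈φA
      ... | T , T⊆A , σT with ⊆⇒⊂⊎≡ T⊆A
      ...   | inj₁ T⊂A  = contradiction (σ∈φ σT) (proper T T⊂A)
      ...   | inj₂ refl = σT

      σ-proper : ∀ B → B ⊂ A → σ B ≢ σ A
      σ-proper B B⊂A σB≡σA = proper B B⊂A (σ∈φ (trans σB≡σA σA))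

    circuit⇒dGenerator : ∀ {x A} → Circuit A x → DGenerator φ x A
    circuit⇒dGenerator {x} {A} circuit@(x∉A , σA , _) =
      σ∈φ σA , x∉A ∘ subst (x ∈_) (φb-id A) , proper
      where
      proper : ∀ B → φb φ B ⊂ φb φ A → x ∉ φ B
      proper B φbB⊂φbA x∈φB with subst₂ _⊂_ (φb-id B) (φb-id A) φbB⊂φbA
      ... | B⊆A , a , a∈A , a∉B =
        a∉B (subst (a ∈_) (sym (circuit-minimal circuit B⊆A x∈φB)) a∈A)

    leastEscape⇒closedCircuit : ∀ {Y S z} → S ⊆ Y → z ∉ Y → σ S ≡ v z →
                                (∀ T → Escapes Y T → ∣ S ∣ ≤ ∣ T ∣) → ClosedCircuit S z
    leastEscape⇒closedCircuit {Y} {S} {z} S⊆Y z∉Y σS least =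
      (z∉Y ∘ S⊆Y , σS , minimal⇒independent proper) , flat
      where
      proper : ∀ B → B ⊂ S → σ B ≢ σ S
      proper B B⊂S σB≡σS =
        <⇒≱ (p⊂q⇒∣p∣<∣q∣ B⊂S) (least B (⊆-trans (proj₁ B⊂S) S⊆Y , z , z∉Y , trans σB≡σS σS))

      flat : ∀ {y} → y ∈ φ S → y ∉ S → y ≡ z
      flat {y} y∈φS y∉S with ∈φ⁻ y∈φS | y ∈? Y
      ... | T , T⊆S , σT | no y∉Y with ⊆⇒⊂⊎≡ T⊆S
      ...   | inj₁ T⊂S  = contradiction (least T (⊆-trans T⊆S S⊆Y , y , y∉Y , σT))
                                        (<⇒≱ (p⊂q⇒∣p∣<∣q∣ T⊂S))
      ...   | inj₂ refl = v-injective y z (trans (sym σT) σS)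
      flat {y} y∈φS y∉S | T , T⊆S , σT | yes y∈Y with two-elements (y∉S ∘ T⊆S) σT
      ...   | t , t' , t∈T , t'∈T , t≢t' =
        contradiction (least (exchange S T y) (exchange-⊆ T⊆S S⊆Y y∈Y , z , z∉Y , σR))
                      (<⇒≱ (∣exchange∣<∣∣ T⊆S t∈T t'∈T t≢t'))
        where σR = trans (σ-exchange {S} {T} σT) σS

    closedCircuit-escaping : ∀ {Y y} → y ∈ φ Y → y ∉ Y →
                             ∃₂ λ S z → S ⊆ Y × z ∉ Y × ClosedCircuit S z
    closedCircuit-escaping {Y} {y} y∈φY y∉Y with ∈φ⁻ y∈φY
    ... | S₀ , S₀⊆Y , σS₀ with minCard (escapes? Y) (S₀⊆Y , y , y∉Y , σS₀)
    ... | S , (S⊆Y , z , z∉Y , σS) , least =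
      S , z , S⊆Y , z∉Y , leastEscape⇒closedCircuit S⊆Y z∉Y σS least

    quasiClosed⇒closedCircuit : ∀ {A} → ¬ Closed φ A → QuasiClosed φ A → ∃ (ClosedCircuit A)
    quasiClosed⇒closedCircuit {A} not-closed quasi-closed with ⊆⇒⊂⊎≡ (φ-extensive {A})
    ... | inj₂ A≡φA = contradiction (sym A≡φA) not-closed
    ... | inj₁ (_ , x , x∈φA , x∉A) with closedCircuit-escaping x∈φA x∉A
    ... | S , z , S⊆A , z∉A , cc@((_ , σS , _) , _) = z , subst (λ X → ClosedCircuit X z) S≡A cc
      where
      φS≡φA : φ S ≡ φ A
      φS≡φA with ⊆⇒⊂⊎≡ (φ-monotone S⊆A)
      ... | inj₁ φS⊂φA = contradiction (quasi-closed S S⊆A φS⊂φA (σ∈φ σS)) z∉A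
      ... | inj₂ φS≡φA = φS≡φA

      S≡A : S ≡ A
      S≡A = ⊆-antisym S⊆A
              (closedCircuit-⊆ cc (λ a∈A → subst (_ ∈_) (sym φS≡φA) (φ-extensive a∈A)) z∉A)

    eGenerator-exchange : ∀ {x A T y t} → EGenerator φ x A → T ⊆ A → y ∈ φ A → y ∉ A → y ≢ x →
                          σ T ≡ v y → t ∈ T → t ∈ φ (exchange A T y)
    eGenerator-exchange {x} {A} {T} {y} {t} (dgen , least) T⊆A y∈φA y∉A y≢x σT t∈T
      with dGenerator⇒circuit dgen
    ... | x∉A , σA , _ with circuit-within (∉-exchange T⊆A x∉A (y≢x ∘ sym))
                                           (σ∈φ (trans (σ-exchange {A} {T} σT) σA))
    ... | B , B⊆R , circuit = φ-monotone B⊆R (subst (t ∈_) (sym φB≡φA) (φ-extensive (T⊆A t∈T)))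
      where
      φB≡φA : φ B ≡ φ A
      φB≡φA = least B (circuit⇒dGenerator circuit)
                (φ-closure (exchange-⊆ T⊆A φ-extensive y∈φA ∘ B⊆R))

    eGenerator⇒closedCircuit : ∀ {x A} → EGenerator φ x A → ClosedCircuit A x
    eGenerator⇒closedCircuit {x} {A} egen@(dgen , _) = circuit , flat
      where
      circuit = dGenerator⇒circuit dgen

      flat : ∀ {y} → y ∈ φ A → y ∉ A → y ≡ x
      flat {y} y∈φA y∉A with y ≟ᶠ x | ∈φ⁻ y∈φA
      ... | yes y≡x | _ = y≡x
      ... | no  y≢x | T , T⊆A , σT with two-elements (y∉A ∘ T⊆A) σT
      ...   | t , t' , t∈T , t'∈T , t≢t' = contradiction (sym (x∈⁅y⁆⇒x≡y t (T⊆⁅t⁆ t'∈T))) t≢t'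
        where
        T⊆⁅t⁆ : T ⊆ ⁅ t ⁆
        T⊆⁅t⁆ = exchange-loses (proj₂ (proj₂ circuit)) T⊆A y∉A σT t∈T
                  (eGenerator-exchange egen T⊆A y∈φA y∉A y≢x σT t∈T)

    closedCircuit⇒eGenerator : ∀ {x A} → ClosedCircuit A x → EGenerator φ x A
    closedCircuit⇒eGenerator {x} {A} cc@(circuit , _) = circuit⇒dGenerator circuit , least
      where
      least : ∀ B → DGenerator φ x B → φ B ⊆ φ A → φ B ≡ φ A
      least B dgen φB⊆φA with dGenerator⇒circuit dgen
      ... | x∉B , σB , _ =
        cong φ (circuit-minimal circuit (closedCircuit-⊆ cc (φB⊆φA ∘ φ-extensive) x∉B) (σ∈φ σB))

    eBaseImp⇔closedCircuit : ∀ {A x} → EBaseImp φ A x ⇔ ClosedCircuit A x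
    eBaseImp⇔closedCircuit = mk⇔ to (inj₂ ∘ closedCircuit⇒eGenerator)
      where
      to : ∀ {A x} → EBaseImp φ A x → ClosedCircuit A x
      to (inj₁ (_ , _ , x≢a , x∈φ⁅a⁆)) = contradiction (φ⁅⁆ x∈φ⁅a⁆) x≢a
      to (inj₂ egen)                   = eGenerator⇒closedCircuit egen

    ClosedCircuitImp : Implication φ → Set
    ClosedCircuitImp (A , C) = ∃ λ c → ClosedCircuit A c × C ≡ ⁅ c ⁆

    canonicalBase⇔closedCircuitImp : ∀ {A C} →
                                     CanonicalBase φ (A , C) ⇔ ClosedCircuitImp (A , C)
    canonicalBase⇔closedCircuitImp = mk⇔ to from
      where
      to : ∀ {A C} → CanonicalBase φ (A , C) → ClosedCircuitImp (A , C)
      to ((not-closed , quasi-closed , _) , C≡φA─A)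
        with quasiClosed⇒closedCircuit not-closed quasi-closed
      ... | c , cc = c , cc , trans C≡φA─A (closedCircuit-φ─ cc)

      from : ∀ {A C} → ClosedCircuitImp (A , C) → CanonicalBase φ (A , C)
      from (c , cc , C≡⁅c⁆) =
        closedCircuit⇒pseudoClosed cc , trans C≡⁅c⁆ (sym (closedCircuit-φ─ cc))

    aggregatedEBase⇔closedCircuitImp : ∀ {A C} →
                                       AggregatedEBase φ (A , C) ⇔ ClosedCircuitImp (A , C)
    aggregatedEBase⇔closedCircuitImp {A} {C} = mk⇔ to from
      where
      imp⇒cc : ∀ {y} → EBaseImp φ A y → ClosedCircuit A y
      imp⇒cc = Equivalence.to eBaseImp⇔closedCircuit

      cc⇒imp : ∀ {y} → ClosedCircuit A y → EBaseImp φ A y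
      cc⇒imp = Equivalence.from eBaseImp⇔closedCircuit

      to : AggregatedEBase φ (A , C) → ClosedCircuitImp (A , C)
      to ((c , c∈C) , members) = c , cc c∈C , ⊆-antisym C⊆⁅c⁆ (⁅⁆⊆ c∈C)
        where
        cc : ∀ {y} → y ∈ C → ClosedCircuit A y
        cc y∈C = imp⇒cc (Equivalence.to (members _) y∈C)
        C⊆⁅c⁆ : C ⊆ ⁅ c ⁆
        C⊆⁅c⁆ y∈C =
          subst (_∈ ⁅ c ⁆) (sym (closedCircuit-unique (cc c∈C) (proj₁ (cc y∈C)))) (x∈⁅x⁆ c)

      from : ClosedCircuitImp (A , C) → AggregatedEBase φ (A , C)
      from (c , cc , refl) = (c , x∈⁅x⁆ c) , λ y → mk⇔
        (λ y∈⁅c⁆ → cc⇒imp (subst (ClosedCircuit A) (sym (x∈⁅y⁆⇒x≡y c y∈⁅c⁆)) cc))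
        (λ imp → subst (_∈ ⁅ c ⁆) (sym (closedCircuit-unique cc (proj₁ (imp⇒cc imp)))) (x∈⁅x⁆ c))

    aggregatedEBase-valid : Valid φ (AggregatedEBase φ)
    aggregatedEBase-valid = sound∧complete⇒valid φ φ-extensive φ-closure sound complete
      where
      sound : ∀ {A C} → AggregatedEBase φ (A , C) → C ⊆ φ A
      sound imp with Equivalence.to aggregatedEBase⇔closedCircuitImp imp
      ... | c , ((_ , σA , _) , _) , refl = ⁅⁆⊆ (σ∈φ σA)

      complete : ∀ {Y} → RespectsImps (AggregatedEBase φ) Y → φ Y ⊆ Y
      complete {Y} respects {y} y∈φY = decidable-stable (y ∈? Y) λ y∉Y →
        let S , z , S⊆Y , z∉Y , cc = closedCircuit-escaping y∈φY y∉Y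
            imp = Equivalence.from aggregatedEBase⇔closedCircuitImp (z , cc , refl)
        in  z∉Y (respects S ⁅ z ⁆ imp S⊆Y (x∈⁅x⁆ z))

corollary7 : ∀ (m n : ℕ) (v : Fin n → Vec Bool m) → Simple v →
    (∀ (A C : Subset n) →
      CanonicalBase (matroidClosure v) (A , C) ⇔ AggregatedEBase (matroidClosure v) (A , C))
    × Valid (matroidClosure v) (AggregatedEBase (matroidClosure v))
corollary7 m n v simple =
  (λ A C → ⇔.trans (canonicalBase⇔closedCircuitImp v simple)
                   (⇔.sym (aggregatedEBase⇔closedCircuitImp v simple))) ,
  aggregatedEBase-valid v simple
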